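{- Let $G=(V,E)$ be a $2$-connected graph with no compliant edges. Let $x,y\in V$, let $S$ be the vertex set of a connected component of $G-\{x,y\}$, and let $H$ be the subgraph of $G$ induced by $S\cup\{x,y\}$. If $H$ contains a non-flat $xy$-path of length at least $2$, then $H$ has a subgraph that is an $xy$-halo.
   Context: All graphs are finite and simple. A flat path in $G$ is a path all of whose internal vertices have degree $2$ in $G$; a non-flat path is one with some internal vertex of degree at least $3$ in $G$. An edge $xy$ of $G$ is compliant if $x$ and $y$ are also connected by another flat path in $G$ (besides the edge $xy$). For vertices $x_1,x_2$, a subgraph $H'$ of $G$ is an $x_1x_2$-halo if it consists of a cycle $C$ together with two paths $P_1,P_2$ such that, for $i=1,2$, $P_i$ is an $x_iu_i$-path with $u_i\in C$ and $P_i$ is otherwise disjoint from $C$ ($P_i$ may be the single vertex $x_i$ if $x_i\in C$), the paths $P_1$ and $P_2$ are vertex-disjoint, and $u_1,u_2$ are at distance at least $2$ in $C$. -}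

module Defs where

open import Data.Nat using (ℕ; zero; suc; _≤_; _∸_)
open import Data.Bool using (Bool; true; false; T)
open import Data.Fin using (Fin)
open import Data.Fin.Subset using (Subset) renaming (_∈_ to _∈ₛ_; _∉_ to _∉ₛ_)
open import Data.List using (List; []; _∷_; _++_; take; length; head; last; filterᵇ; allFin)
open import Data.List.Relation.Unary.All using (All)
open import Data.List.Relation.Unary.Any using (Any)
open import Data.List.Relation.Unary.Linked using (Linked)
open import Data.List.Relation.Unary.Unique.Propositional using (Unique)
open import Data.List.Membership.Propositional using (_∈_)
open import Data.Maybe using (just)
open import Data.Product using (Σ; ∃; _×_)
open import Data.Sum using (_⊎_)
open import Data.Empty using (⊥)
open import Relation.Nullary using (¬_)
open import Relation.Binary.PropositionalEquality using (_≡_; _≢_)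

record Graph (n : ℕ) : Set where
  field
    adj    : Fin n → Fin n → Bool
    sym    : ∀ u v → adj u v ≡ adj v u
    irrefl : ∀ v → adj v v ≡ false

open Graph public

module _ {n : ℕ} (G : Graph n) where

  Edge : Fin n → Fin n → Set
  Edge u v = T (adj G u v)

  deg : Fin n → ℕ
  deg v = length (filterᵇ (adj G v) (allFin n))

  IsPath : List (Fin n) → Set
  IsPath xs = Unique xs × Linked Edge xs

  PathFrom : Fin n → Fin n → List (Fin n) → Set
  PathFrom a b xs = IsPath xs × head xs ≡ just a × last xs ≡ just b

-- length (number of edges) of a path given by its vertex list
len : {A : Set} → List A → ℕ
len xs = length xs ∸ 1

dropLast : {A : Set} → List A → List A
dropLast []           = []
dropLast (_ ∷ [])     = []
dropLast (a ∷ b ∷ zs) = a ∷ dropLast (b ∷ zs)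

interior : {A : Set} → List A → List A
interior []       = []
interior (_ ∷ xs) = dropLast xs

data Consec {A : Set} : List A → A → A → Set where
  here  : ∀ {a b l} → Consec (a ∷ b ∷ l) a b
  there : ∀ {c a b l} → Consec l a b → Consec (c ∷ l) a b

module _ {n : ℕ} (G : Graph n) where

  Flat : List (Fin n) → Set
  Flat xs = All (λ v → deg G v ≡ 2) (interior xs)

  NonFlat : List (Fin n) → Set
  NonFlat xs = Any (λ v → 3 ≤ deg G v) (interior xs)

  Compliant : Fin n → Fin n → Set
  Compliant x y = Edge G x y ×
    (∃ λ xs → PathFrom G x y xs × Flat xs × xs ≢ (x ∷ y ∷ []))

  NoCompliantEdges : Set
  NoCompliantEdges = ∀ x y → ¬ Compliant x y

  Connected : Set
  Connected = ∀ u v → ∃ λ xs → PathFrom G u v xs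

  -- 2-connected: at least 3 vertices, connected, and no cut vertex
  TwoConnected : Set
  TwoConnected = 3 ≤ n × Connected ×
    (∀ w u v → u ≢ w → v ≢ w → ∃ λ xs → PathFrom G u v xs × All (λ z → z ≢ w) xs)

  IsComponent : Fin n → Fin n → Subset n → Set
  IsComponent x y S =
    x ∉ₛ S × y ∉ₛ S ×
    (∃ λ v → v ∈ₛ S) ×
    (∀ u v → u ∈ₛ S → v ∈ₛ S → ∃ λ xs → PathFrom G u v xs × All (_∈ₛ S) xs) ×
    (∀ u v → u ∈ₛ S → Edge G u v → v ≢ x → v ≢ y → v ∈ₛ S)

  InH : Subset n → Fin n → Fin n → Fin n → Set
  InH S x y v = v ∈ₛ S ⊎ v ≡ x ⊎ v ≡ y

  IsCycle : List (Fin n) → Set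
  IsCycle cs = Unique cs × 3 ≤ length cs × Linked (Edge G) (cs ++ take 1 cs)

  CycAdj : List (Fin n) → Fin n → Fin n → Set
  CycAdj cs u v = Consec (cs ++ take 1 cs) u v ⊎ Consec (cs ++ take 1 cs) v u

  -- a subgraph of H = G[S ∪ {x,y}] that is an x₁x₂-halo (all vertices in H;
  -- all edges used are edges of G, hence of the induced subgraph H)
  HaloIn : Subset n → Fin n → Fin n → Fin n → Fin n → Set
  HaloIn S x y x₁ x₂ =
    Σ (List (Fin n)) λ C → Σ (List (Fin n)) λ P₁ → Σ (List (Fin n)) λ P₂ →
    Σ (Fin n) λ u₁ → Σ (Fin n) λ u₂ →
      IsCycle C × All (InH S x y) C ×
      PathFrom G x₁ u₁ P₁ × All (InH S x y) P₁ × u₁ ∈ C ×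
      (∀ v → v ∈ P₁ → v ∈ C → v ≡ u₁) ×
      PathFrom G x₂ u₂ P₂ × All (InH S x y) P₂ × u₂ ∈ C ×
      (∀ v → v ∈ P₂ → v ∈ C → v ≡ u₂) ×
      (∀ v → v ∈ P₁ → v ∈ P₂ → ⊥) ×
      u₁ ≢ u₂ × ¬ CycAdj C u₁ u₂

-- An internal vertex b of the non-flat path P has a third neighbour w; following a w–x path that
-- avoids b (2-connectivity) up to its first vertex on P gives an ear of P at b, whose interior
-- avoids x and y and so lies in S. For an ear I from u to v write P = A u B v D. If B and I are
-- both nonempty, u I v B⁻¹ is a cycle on which u and v are not adjacent, attached to x and y by
-- A u and (v D)⁻¹: a halo. If I is empty, uv is a chord over B; if B is empty, replacing the edge
-- uv by the ear gives a longer path with the chord uv over I. A chord over a nonempty segment is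
-- not compliant, so the segment contains a vertex of degree at least 3, whose ear either lands
-- outside the segment, giving a halo on the path shortcut through the chord, or produces a
-- configuration strictly inside the segment. As P has at most n vertices and the segment shrinks
-- while P is fixed, a halo is reached.

module Submission where

open import Defs hiding (sym)

open import Data.Bool using (T)
open import Data.Bool.Properties using (T?)
open import Data.Empty using (⊥-elim)
open import Data.Fin using (Fin)
import Data.Fin.Properties as Fin
open import Data.Fin.Subset using (Subset) renaming (_∈_ to _∈ₛ_)
open import Data.List using (List; []; _∷_; _++_; _∷ʳ_; length; head; last; reverse; allFin; lookup; initLast; _∷ʳ′_)
open import Data.List.Properties
  using (++-assoc; ++-conicalʳ; ∷-injective; ∷-injectiveʳ; length-++-≤ʳ; reverse-++; reverse-injective; unfold-reverse)
open import Data.List.Membership.Propositional using (_∈_; _∉_; find)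
open import Data.List.Membership.Propositional.Properties
  using (∈-++⁺ˡ; ∈-++⁺ʳ; ∈-++⁻; ∈-∃++; ∈-filter⁺; ∈-filter⁻; ∈-allFin; ∈-lookup)
open import Data.List.Relation.Binary.Disjoint.Propositional using (Disjoint)
open import Data.List.Relation.Binary.Subset.Propositional using (_⊆_)
import Data.List.Relation.Binary.Subset.Propositional.Properties as Subset
open import Data.List.Relation.Unary.All using (All; []; _∷_)
import Data.List.Relation.Unary.All as All
import Data.List.Relation.Unary.All.Properties as All
open import Data.List.Relation.Unary.AllPairs using ([]; _∷_)
open import Data.List.Relation.Unary.Any using (Any; here; there)
open import Data.List.Relation.Unary.Any.Properties using (reverse⁻)
import Data.List.Relation.Unary.First as First
open import Data.List.Relation.Unary.First.Properties using (toView)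
open import Data.List.Relation.Unary.Linked using (Linked; []; [-]; _∷_)
import Data.List.Relation.Unary.Linked as Linked
open import Data.List.Relation.Unary.Unique.Propositional using (Unique)
open import Data.List.Relation.Unary.Unique.Propositional.Properties using (filter⁺; allFin⁺) renaming (++⁺ to Unique-++⁺)
open import Data.Maybe using (just)
open import Data.Maybe.Properties using (just-injective)
open import Data.Nat using (ℕ; zero; suc; _≤_; _<_; _∸_; z≤n; s≤s; _≟_)
open import Data.Nat.Properties using (≤-trans; ≤-refl; ≤-pred; <-≤-trans; ∸-monoʳ-<; >⇒≢; m≤n⇒m≤1+n)
open import Data.Product using (∃; ∃₂; _×_; _,_; proj₁; proj₂)
open import Data.Sum using (_⊎_; inj₁; inj₂; [_,_]′; swap)
open import Function using (_∘_; case_of_)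
open import Relation.Binary.Definitions using (Symmetric)
open import Relation.Binary.PropositionalEquality using (_≡_; _≢_; refl; sym; trans; cong; subst)
open import Relation.Nullary using (¬_; yes; no)
open import Relation.Nullary.Decidable using (_×-dec_; ¬?; toSum)

module _ {A : Set} where

  Unique-++⁻ : ∀ (xs : List A) {ys} → Unique (xs ++ ys) → Unique xs × Unique ys × Disjoint xs ys
  Unique-++⁻ []       u          = [] , u , λ ()
  Unique-++⁻ (x ∷ xs) (x∉ ∷ u) with Unique-++⁻ xs u
  ... | uxs , uys , xs#ys = All.++⁻ˡ xs x∉ ∷ uxs , uys , λ where
    (here refl , z∈ys) → All.lookup (All.++⁻ʳ xs x∉) z∈ys refl
    (there z∈xs , z∈ys) → xs#ys (z∈xs , z∈ys)

  Unique-reverse : ∀ {xs : List A} → Unique xs → Unique (reverse xs)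
  Unique-reverse {[]}     []         = []
  Unique-reverse {x ∷ xs} (x∉ ∷ u) rewrite unfold-reverse x xs =
    Unique-++⁺ (Unique-reverse u) ([] ∷ []) λ where
      (x∈ , here refl) → All.lookup x∉ (reverse⁻ x∈) refl

  Unique-suffix : ∀ (l l′ : List A) {a r r′} → Unique (l ++ a ∷ r) → l ++ a ∷ r ≡ l′ ++ a ∷ r′ → r ≡ r′
  Unique-suffix []      []       _        eq = ∷-injectiveʳ eq
  Unique-suffix []      (b ∷ l′) (a∉ ∷ _) eq with refl , eq′ ← ∷-injective eq =
    ⊥-elim (All.lookup a∉ (subst (_ ∈_) (sym eq′) (∈-++⁺ʳ l′ (here refl))) refl)
  Unique-suffix (b ∷ l) []       (b∉ ∷ _) eq with refl , _ ← ∷-injective eq =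
    ⊥-elim (All.lookup b∉ (∈-++⁺ʳ l (here refl)) refl)
  Unique-suffix (b ∷ l) (c ∷ l′) (_ ∷ u)  eq = Unique-suffix l l′ u (∷-injectiveʳ eq)

  Unique-rotate : ∀ {x} {xs : List A} → Unique (x ∷ xs) → Unique (xs ∷ʳ x)
  Unique-rotate (x∉ ∷ u) = Unique-++⁺ u ([] ∷ []) λ { (x∈ , here refl) → All.lookup x∉ x∈ refl }

  Consec⇒++ : ∀ {xs : List A} {a b} → Consec xs a b → ∃₂ λ l r → xs ≡ l ++ a ∷ b ∷ r
  Consec⇒++ {a ∷ b ∷ r} here = [] , r , refl
  Consec⇒++ {c ∷ xs}    (there c∈) with l , r , refl ← Consec⇒++ c∈ = c ∷ l , r , refl

  Consec-successor : ∀ (l : List A) {a b r} → Unique (l ++ a ∷ r) → Consec (l ++ a ∷ r) a b → head r ≡ just b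
  Consec-successor l u ab with l′ , r′ , eq ← Consec⇒++ ab rewrite Unique-suffix l l′ u eq = refl

  head-++ : ∀ (xs : List A) {y ys} → head (xs ++ y ∷ ys) ≡ head (xs ∷ʳ y)
  head-++ []       = refl
  head-++ (x ∷ xs) = refl

  last-++ : ∀ (xs : List A) {y ys} → last (xs ++ y ∷ ys) ≡ last (y ∷ ys)
  last-++ []           = refl
  last-++ (x ∷ [])     = refl
  last-++ (x ∷ x′ ∷ xs) = last-++ (x′ ∷ xs)

  head⇒∈ : ∀ {xs : List A} {z} → head xs ≡ just z → z ∈ xs
  head⇒∈ {x ∷ xs} refl = here refl

  last⇒∈ : ∀ {xs : List A} {z} → last xs ≡ just z → z ∈ xs
  last⇒∈ {x ∷ []}      refl = here refl
  last⇒∈ {x ∷ x′ ∷ xs} eq   = there (last⇒∈ {x′ ∷ xs} eq)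

  head-reverse : ∀ (xs : List A) → head (reverse xs) ≡ last xs
  head-reverse xs with initLast xs
  ... | []       = refl
  ... | ys ∷ʳ′ y = trans (cong head (reverse-++ ys (y ∷ []))) (sym (last-++ ys))

  last-reverse : ∀ (xs : List A) → last (reverse xs) ≡ head xs
  last-reverse []       = refl
  last-reverse (x ∷ xs) = trans (cong last (unfold-reverse x xs)) (last-++ (reverse xs))

  locate-in-++ : ∀ (l : List A) {e r} (xs : List A) {ys} → l ++ e ∷ r ≡ xs ++ ys →
    (∃ λ xs₂ → xs ≡ l ++ e ∷ xs₂ × r ≡ xs₂ ++ ys) ⊎
    (∃ λ ys₁ → ys ≡ ys₁ ++ e ∷ r × l ≡ xs ++ ys₁)
  locate-in-++ l       []       eq = inj₂ (l , sym eq , refl)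
  locate-in-++ []      (x ∷ xs) eq with refl , eq′ ← ∷-injective eq = inj₁ (xs , refl , eq′)
  locate-in-++ (z ∷ l) (x ∷ xs) eq with refl , eq′ ← ∷-injective eq with locate-in-++ l xs eq′
  ... | inj₁ (xs₂ , refl , r≡) = inj₁ (xs₂ , refl , r≡)
  ... | inj₂ (ys₁ , ys≡ , refl) = inj₂ (ys₁ , ys≡ , refl)

  Unique-insert⁺ : ∀ xs {y ys zs} → Unique (xs ++ y ∷ zs) → Unique ys → Disjoint ys (xs ++ y ∷ zs) →
    Unique (xs ++ y ∷ ys ++ zs)
  Unique-insert⁺ xs {y} {ys} {zs} u uys ys# =
    let uxy , uzs , xy#zs = Unique-++⁻ (xs ∷ʳ y) (subst Unique (sym (++-assoc xs (y ∷ []) zs)) u)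
        xy⊆ : xs ∷ʳ y ⊆ xs ++ y ∷ zs
        xy⊆ = Subset.++⁺ʳ xs (Subset.xs⊆xs++ys (y ∷ []) zs)
    in subst Unique (++-assoc xs (y ∷ []) (ys ++ zs)) (Unique-++⁺ uxy
         (Unique-++⁺ uys uzs λ (p , q) → ys# (p , ∈-++⁺ʳ xs (there q)))
         λ (p , q) → [ (λ q → ys# (q , xy⊆ p)) , (λ q → xy#zs (p , q)) ]′ (∈-++⁻ ys q))

  Unique-insert⁻ : ∀ xs {y ys zs} → Unique (xs ++ y ∷ ys ++ zs) →
    Unique (xs ++ y ∷ zs) × Unique ys × Disjoint ys (xs ++ y ∷ zs)
  Unique-insert⁻ xs {y} {ys} {zs} u =
    let uxy , uyz , xy#yz = Unique-++⁻ (xs ∷ʳ y) (subst Unique (sym (++-assoc xs (y ∷ []) (ys ++ zs))) u)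
        uys , uzs , ys#zs = Unique-++⁻ ys uyz
        ∈-reassoc : ∀ {z} → z ∈ xs ++ y ∷ zs → z ∈ (xs ∷ʳ y) ++ zs
        ∈-reassoc = subst (_ ∈_) (sym (++-assoc xs (y ∷ []) zs))
    in subst Unique (++-assoc xs (y ∷ []) zs) (Unique-++⁺ uxy uzs λ (p , q) → xy#yz (p , ∈-++⁺ʳ ys q)) ,
       uys ,
       λ (p , q) → [ (λ q → xy#yz (q , ∈-++⁺ˡ p)) , (λ q → ys#zs (p , q)) ]′
                     (∈-++⁻ (xs ∷ʳ y) (∈-reassoc q))

  All-insert⁺ : ∀ {P : A → Set} xs {y ys zs} → All P (xs ++ y ∷ zs) → All P ys → All P (xs ++ y ∷ ys ++ zs)
  All-insert⁺ xs pxyz pys with pxs , py ∷ pzs ← All.++⁻ xs pxyz = All.++⁺ pxs (py ∷ All.++⁺ pys pzs)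

  All-insert⁻ : ∀ {P : A → Set} xs {y ys zs} → All P (xs ++ y ∷ ys ++ zs) → All P (xs ++ y ∷ zs) × All P ys
  All-insert⁻ xs {ys = ys} p with pxs , py ∷ pyz ← All.++⁻ xs p with pys , pzs ← All.++⁻ ys pyz =
    All.++⁺ pxs (py ∷ pzs) , pys

  last-segments : ∀ xs {u ys v zs} → last (xs ++ u ∷ ys ++ v ∷ zs) ≡ last (v ∷ zs)
  last-segments xs {u} {ys} = trans (last-++ xs) (last-++ (u ∷ ys))

  reverse-∷-∷ʳ : ∀ u (xs : List A) v → reverse (u ∷ xs ∷ʳ v) ≡ v ∷ reverse xs ∷ʳ u
  reverse-∷-∷ʳ u xs v = trans (unfold-reverse u (xs ∷ʳ v)) (cong (_∷ʳ u) (reverse-++ xs (v ∷ [])))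

  Unique-segments⁻ : ∀ xs {u ys v zs} → Unique (xs ++ u ∷ ys ++ v ∷ zs) →
    Unique ys × Disjoint (xs ∷ʳ u) (ys ++ v ∷ zs) × Disjoint ys (v ∷ zs)
  Unique-segments⁻ xs {u} {ys} {v} {zs} uniq
    with _ , uyz , xu#yz
           ← Unique-++⁻ (xs ∷ʳ u) (subst Unique (sym (++-assoc xs (u ∷ []) (ys ++ v ∷ zs))) uniq)
    with uys , _ , ys#vzs ← Unique-++⁻ ys uyz
    = uys , xu#yz , ys#vzs

  ∈-cycle⁻ : ∀ {u v z} (I B : List A) → z ∈ u ∷ I ++ v ∷ reverse B → z ∈ I ⊎ z ∈ u ∷ B ∷ʳ v
  ∈-cycle⁻ I B (here eq) = inj₂ (here eq)
  ∈-cycle⁻ I B (there z∈) with ∈-++⁻ I z∈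
  ... | inj₁ z∈I            = inj₁ z∈I
  ... | inj₂ (here eq)      = inj₂ (there (∈-++⁺ʳ B (here eq)))
  ... | inj₂ (there z∈revB) = inj₂ (there (∈-++⁺ˡ (reverse⁻ {xs = B} z∈revB)))

  Unique-cycle : ∀ {u v} (I B : List A) → Unique (u ∷ B ∷ʳ v) → Unique I → Disjoint I (u ∷ B ∷ʳ v) →
    Unique (u ∷ I ++ v ∷ reverse B)
  Unique-cycle {u} {v} I B (u∉Bv ∷ uniq-Bv) uniq-I I# =
    All.¬Any⇒All¬ _ u∉ ∷ Unique-++⁺ uniq-I (All.¬Any⇒All¬ _ v∉ ∷ Unique-reverse (proj₁ split-Bv)) I#vB
    where
    split-Bv = Unique-++⁻ B uniq-Bv
    u∉ : u ∉ I ++ v ∷ reverse B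
    u∉ u∈ with ∈-++⁻ I u∈
    ... | inj₁ u∈I            = I# (u∈I , here refl)
    ... | inj₂ (here u≡v)     = All.lookup u∉Bv (∈-++⁺ʳ B (here refl)) u≡v
    ... | inj₂ (there u∈revB) = All.lookup u∉Bv (∈-++⁺ˡ (reverse⁻ {xs = B} u∈revB)) refl
    v∉ : v ∉ reverse B
    v∉ v∈ = proj₂ (proj₂ split-Bv) (reverse⁻ v∈ , here refl)
    I#vB : Disjoint I (v ∷ reverse B)
    I#vB (p , here refl) = I# (p , there (∈-++⁺ʳ B (here refl)))
    I#vB (p , there q)   = I# (p , there (∈-++⁺ˡ (reverse⁻ {xs = B} q)))

  dropLast-∷ʳ : ∀ (xs : List A) v → dropLast (xs ∷ʳ v) ≡ xs
  dropLast-∷ʳ []           v = refl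
  dropLast-∷ʳ (x ∷ [])     v = refl
  dropLast-∷ʳ (x ∷ x′ ∷ xs) v = cong (x ∷_) (dropLast-∷ʳ (x′ ∷ xs) v)

  ++-∷-≢-[] : ∀ (xs : List A) {y ys} → xs ++ y ∷ ys ≢ []
  ++-∷-≢-[] xs {y} {ys} eq with () ← ++-conicalʳ xs (y ∷ ys) eq

  ++-regroup : ∀ (xs : List A) {u} ys {q} zs ws →
    xs ++ u ∷ (ys ++ q ∷ zs) ++ ws ≡ (xs ++ u ∷ ys) ++ q ∷ zs ++ ws
  ++-regroup xs {u} ys {q} zs ws =
    trans (cong (λ t → xs ++ u ∷ t) (++-assoc ys (q ∷ zs) ws)) (sym (++-assoc xs (u ∷ ys) (q ∷ zs ++ ws)))

  insert-⊆ : ∀ (xs : List A) {y ys zs} → xs ++ y ∷ zs ⊆ xs ++ y ∷ ys ++ zs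
  insert-⊆ xs {y} {ys} {zs} p with ∈-++⁻ xs p
  ... | inj₁ p∈xs       = ∈-++⁺ˡ p∈xs
  ... | inj₂ (here eq)  = ∈-++⁺ʳ xs (here eq)
  ... | inj₂ (there p∈) = ∈-++⁺ʳ xs (there (∈-++⁺ʳ ys p∈))

  length-∷ʳ : ∀ (xs : List A) {v} → length (xs ∷ʳ v) ≡ suc (length xs)
  length-∷ʳ []       = refl
  length-∷ʳ (x ∷ xs) = cong suc (length-∷ʳ xs)

  length-prefix< : ∀ (xs : List A) {e ys} → length xs < length (xs ++ e ∷ ys)
  length-prefix< []       = s≤s z≤n
  length-prefix< (x ∷ xs) = s≤s (length-prefix< xs)

  length-suffix< : ∀ (xs : List A) {e} ys → length ys < length (xs ++ e ∷ ys)
  length-suffix< []       ys = ≤-refl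
  length-suffix< (x ∷ xs) ys = m≤n⇒m≤1+n (length-suffix< xs ys)

  length-insert< : ∀ (xs : List A) {y z zs} ys → length (xs ++ y ∷ zs) < length (xs ++ y ∷ z ∷ ys ++ zs)
  length-insert< []       {zs = zs} ys = s≤s (s≤s (length-++-≤ʳ zs {ys}))
  length-insert< (x ∷ xs) ys = s≤s (length-insert< xs ys)

  Any-interior⇒split : ∀ {P : A → Set} xs → Any P (interior xs) →
    ∃₂ λ L R → ∃ λ b → xs ≡ L ++ b ∷ R × L ≢ [] × R ≢ [] × P b
  Any-interior⇒split (x₀ ∷ T) any with initLast T
  ... | [] with () ← any
  ... | T′ ∷ʳ′ z
    with b , b∈ , pb ← find (subst (Any _) (dropLast-∷ʳ T′ z) any)
    with M₁ , M₂ , refl ← ∈-∃++ b∈ =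
    x₀ ∷ M₁ , M₂ ∷ʳ z , b , cong (x₀ ∷_) (++-assoc M₁ (b ∷ M₂) (z ∷ [])) , (λ ()) , ++-∷-≢-[] M₂ , pb

  module _ {R : A → A → Set} where

    Linked-++⁻ : ∀ (xs : List A) {y ys} → Linked R (xs ++ y ∷ ys) → Linked R (xs ∷ʳ y) × Linked R (y ∷ ys)
    Linked-++⁻ []            l       = [-] , l
    Linked-++⁻ (x ∷ [])      (r ∷ l) = r ∷ [-] , l
    Linked-++⁻ (x ∷ x′ ∷ xs) (r ∷ l) with l₁ , l₂ ← Linked-++⁻ (x′ ∷ xs) l = r ∷ l₁ , l₂

    Linked-∷⁺ : ∀ {x w xs} → R x w → head xs ≡ just w → Linked R xs → Linked R (x ∷ xs)
    Linked-∷⁺ {xs = _ ∷ _} r refl l = r ∷ l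

    Linked-++⁺ : ∀ (xs : List A) {y ys} → Linked R (xs ∷ʳ y) → Linked R (y ∷ ys) → Linked R (xs ++ y ∷ ys)
    Linked-++⁺ []            _        l = l
    Linked-++⁺ (x ∷ [])      (r ∷ _)  l = r ∷ l
    Linked-++⁺ (x ∷ x′ ∷ xs) (r ∷ l₁) l = r ∷ Linked-++⁺ (x′ ∷ xs) l₁ l

    Linked-reverse : Symmetric R → ∀ {xs} → Linked R xs → Linked R (reverse xs)
    Linked-reverse R-sym []                    = []
    Linked-reverse R-sym [-]                   = [-]
    Linked-reverse R-sym {x ∷ y ∷ zs} (r ∷ l) = subst (Linked R) reverse-x∷y∷zs
      (Linked-++⁺ (reverse zs) (subst (Linked R) (unfold-reverse y zs) (Linked-reverse R-sym l)) (R-sym r ∷ [-]))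
      where
      reverse-x∷y∷zs : reverse zs ++ y ∷ x ∷ [] ≡ reverse (x ∷ y ∷ zs)
      reverse-x∷y∷zs = sym (trans (unfold-reverse x (y ∷ zs))
        (trans (cong (_∷ʳ x) (unfold-reverse y zs)) (++-assoc (reverse zs) (y ∷ []) (x ∷ []))))

    Linked-reverse-∷-∷ʳ : Symmetric R → ∀ {u xs v} → Linked R (u ∷ xs ∷ʳ v) → Linked R (v ∷ reverse xs ∷ʳ u)
    Linked-reverse-∷-∷ʳ R-sym {u} {xs} {v} l = subst (Linked R) (reverse-∷-∷ʳ u xs v) (Linked-reverse R-sym l)

    Linked-segments⁻ : ∀ xs {u ys v zs} → Linked R (xs ++ u ∷ ys ++ v ∷ zs) →
      Linked R (xs ∷ʳ u) × Linked R (u ∷ ys ∷ʳ v) × Linked R (v ∷ zs)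
    Linked-segments⁻ xs {u} {ys} l
      with l₁ , l₂ ← Linked-++⁻ xs l
      with l₃ , l₄ ← Linked-++⁻ (u ∷ ys) l₂
      = l₁ , l₃ , l₄

    Linked-segments⁺ : ∀ xs {u ys v zs} → Linked R (xs ∷ʳ u) → Linked R (u ∷ ys ∷ʳ v) → Linked R (v ∷ zs) →
      Linked R (xs ++ u ∷ ys ++ v ∷ zs)
    Linked-segments⁺ xs {u} {ys} l₁ l₂ l₃ = Linked-++⁺ xs l₁ (Linked-++⁺ (u ∷ ys) l₂ l₃)

  Unique-lookup-injective : ∀ {xs : List A} → Unique xs → ∀ {i j} → lookup xs i ≡ lookup xs j → i ≡ j
  Unique-lookup-injective {x ∷ xs} _        {Fin.zero}  {Fin.zero}  _  = refl
  Unique-lookup-injective {x ∷ xs} (x∉ ∷ _) {Fin.zero}  {Fin.suc j} eq = ⊥-elim (All.lookup x∉ (∈-lookup j) eq)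
  Unique-lookup-injective {x ∷ xs} (x∉ ∷ _) {Fin.suc i} {Fin.zero}  eq = ⊥-elim (All.lookup x∉ (∈-lookup i) (sym eq))
  Unique-lookup-injective {x ∷ xs} (_ ∷ u)  {Fin.suc i} {Fin.suc j} eq = cong Fin.suc (Unique-lookup-injective u eq)

  Unique-pair⇒length≡2 : ∀ {xs : List A} {a c} → Unique xs → a ∈ xs → c ∈ xs → a ≢ c →
    (∀ {z} → z ∈ xs → z ≡ a ⊎ z ≡ c) → length xs ≡ 2
  Unique-pair⇒length≡2 {[]}              _ ()
  Unique-pair⇒length≡2 {_ ∷ []}          _ (here refl) (here refl) a≢c _ = ⊥-elim (a≢c refl)
  Unique-pair⇒length≡2 {_ ∷ _ ∷ []}      _ _ _ _ _ = refl
  Unique-pair⇒length≡2 {_ ∷ _ ∷ _ ∷ _} ((≢₁₂ ∷ ≢₁₃ ∷ _) ∷ (≢₂₃ ∷ _) ∷ _) _ _ _ pair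
    with pair (here refl) | pair (there (here refl)) | pair (there (there (here refl)))
  ... | inj₁ refl | inj₁ refl | _         = ⊥-elim (≢₁₂ refl)
  ... | inj₂ refl | inj₂ refl | _         = ⊥-elim (≢₁₂ refl)
  ... | inj₁ refl | inj₂ refl | inj₁ refl = ⊥-elim (≢₁₃ refl)
  ... | inj₁ refl | inj₂ refl | inj₂ refl = ⊥-elim (≢₂₃ refl)
  ... | inj₂ refl | inj₁ refl | inj₁ refl = ⊥-elim (≢₂₃ refl)
  ... | inj₂ refl | inj₁ refl | inj₂ refl = ⊥-elim (≢₁₃ refl)

Unique⇒length≤ : ∀ {n} {xs : List (Fin n)} → Unique xs → length xs ≤ n
Unique⇒length≤ u = Fin.injective⇒≤ (Unique-lookup-injective u)

module _ {n : ℕ} (G : Graph n) where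

  Edge-sym : Symmetric (Edge G)
  Edge-sym {u} {v} = subst T (Graph.sym G u v)

  Edge-irrefl : ∀ {v} → ¬ Edge G v v
  Edge-irrefl {v} = subst T (irrefl G v)

  third-neighbour : ∀ {b a c} → a ≢ c → Edge G b a → Edge G b c → deg G b ≢ 2 →
    ∃ λ w → Edge G b w × w ≢ a × w ≢ c
  third-neighbour {b} {a} {c} a≢c ba bc deg≢2
    with Fin.any? (λ w → T? (adj G b w) ×-dec ¬? (w Fin.≟ a) ×-dec ¬? (w Fin.≟ c))
  ... | yes (w , bw , w≢a , w≢c) = w , bw , w≢a , w≢c
  ... | no ∄w = ⊥-elim (deg≢2 (Unique-pair⇒length≡2 (filter⁺ adj? (allFin⁺ n))
                  (∈-filter⁺ adj? (∈-allFin a) ba) (∈-filter⁺ adj? (∈-allFin c) bc) a≢c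
                  (λ z∈ → a-or-c (proj₂ (∈-filter⁻ adj? {xs = allFin n} z∈)))))
    where
    adj? = λ w → T? (adj G b w)
    a-or-c : ∀ {z} → Edge G b z → z ≡ a ⊎ z ≡ c
    a-or-c {z} bz with z Fin.≟ a | z Fin.≟ c
    ... | yes z≡a | _       = inj₁ z≡a
    ... | no _    | yes z≡c = inj₂ z≡c
    ... | no z≢a  | no z≢c  = ⊥-elim (∄w (z , bz , z≢a , z≢c))

  PathFrom-prefix : ∀ {a b} xs {u ys} → PathFrom G a b (xs ++ u ∷ ys) → PathFrom G a u (xs ∷ʳ u)
  PathFrom-prefix xs {u} {ys} ((uniq , linked) , hd , _) =
    (proj₁ (Unique-++⁻ (xs ∷ʳ u) (subst Unique (sym (++-assoc xs (u ∷ []) ys)) uniq)) ,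
     proj₁ (Linked-++⁻ xs linked)) ,
    trans (sym (head-++ xs)) hd , last-++ xs

  PathFrom-suffix : ∀ {a b} xs {v ys} → PathFrom G a b (xs ++ v ∷ ys) → PathFrom G v b (v ∷ ys)
  PathFrom-suffix xs ((uniq , linked) , _ , lst) =
    (proj₁ (proj₂ (Unique-++⁻ xs uniq)) , proj₂ (Linked-++⁻ xs linked)) , refl , trans (sym (last-++ xs)) lst

  PathFrom-reverse : ∀ {a b xs} → PathFrom G a b xs → PathFrom G b a (reverse xs)
  PathFrom-reverse {xs = xs} ((uniq , linked) , hd , lst) =
    (Unique-reverse uniq , Linked-reverse Edge-sym linked) , trans (head-reverse xs) lst , trans (last-reverse xs) hd

  detour-has-branch-vertex : NoCompliantEdges G → ∀ {u v} M → Edge G u v → IsPath G (u ∷ M ∷ʳ v) → M ≢ [] →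
    Any (λ q → deg G q ≢ 2) M
  detour-has-branch-vertex _  []         _  _    M≢[] = ⊥-elim (M≢[] refl)
  detour-has-branch-vertex nc {u} {v} (m ∷ M) uv path _ =
    All.¬All⇒Any¬ (λ q → deg G q ≟ 2) (m ∷ M) λ flat →
    nc u v (uv , u ∷ m ∷ M ∷ʳ v , (path , refl , last-++ (u ∷ m ∷ M)) ,
            subst (All _) (sym (dropLast-∷ʳ (m ∷ M) v)) flat , not-the-edge)
    where
    not-the-edge : u ∷ m ∷ M ∷ʳ v ≢ u ∷ v ∷ []
    not-the-edge eq with () ← ++-conicalʳ M (v ∷ []) (∷-injectiveʳ (∷-injectiveʳ eq))

  IsPath-segment : ∀ xs {u ys v zs} → IsPath G (xs ++ u ∷ ys ++ v ∷ zs) → IsPath G (u ∷ ys ∷ʳ v)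
  IsPath-segment xs {u} {ys} {v} {zs} (uniq , linked) =
    proj₁ (Unique-++⁻ (u ∷ ys ∷ʳ v)
      (subst Unique (cong (u ∷_) (sym (++-assoc ys (v ∷ []) zs))) (proj₁ (proj₂ (Unique-++⁻ xs uniq))))) ,
    proj₁ (proj₂ (Linked-segments⁻ xs linked))

  IsPath-neighbours : ∀ L {a b c} R → IsPath G ((L ∷ʳ a) ++ b ∷ c ∷ R) → Edge G b a × Edge G b c × a ≢ c
  IsPath-neighbours L {a} {b} {c} R (uniq , linked) =
    Edge-sym (Linked.head (proj₂
      (Linked-++⁻ L (subst (Linked (Edge G)) (++-assoc L (a ∷ []) (b ∷ c ∷ R)) linked)))) ,
    Linked.head (proj₂ (Linked-++⁻ (L ∷ʳ a) linked)) ,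
    λ a≡c → proj₂ (proj₂ (Unique-++⁻ (L ∷ʳ a) uniq)) (∈-++⁺ʳ L (here refl) , there (here a≡c))

  IsCycle-of-paths : ∀ {u v} I J → Linked (Edge G) (u ∷ I ∷ʳ v) → Linked (Edge G) (v ∷ J ∷ʳ u) →
    Unique (u ∷ I ++ v ∷ J) → I ≢ [] → IsCycle G (u ∷ I ++ v ∷ J)
  IsCycle-of-paths []      _ _   _   _    I≢[] = ⊥-elim (I≢[] refl)
  IsCycle-of-paths {u} {v} (i ∷ I) J uIv vJu uniq _ =
    uniq , s≤s (s≤s (≤-trans (s≤s z≤n) (length-++-≤ʳ (v ∷ J) {I}))) ,
    subst (Linked (Edge G)) (cong (u ∷_) (sym (++-assoc (i ∷ I) (v ∷ J) (u ∷ []))))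
      (Linked-++⁺ (u ∷ i ∷ I) uIv vJu)

  ¬CycAdj-opposite : ∀ {u v} I J → Unique (u ∷ I ++ v ∷ J) → I ≢ [] → J ≢ [] →
    ¬ CycAdj G (u ∷ I ++ v ∷ J) u v
  ¬CycAdj-opposite []      _       _ I≢[] _    _ = I≢[] refl
  ¬CycAdj-opposite (_ ∷ _) []      _ _    J≢[] _ = J≢[] refl
  ¬CycAdj-opposite (i ∷ I) (j ∷ J) (_ ∷ i∉ ∷ _) _ _ (inj₁ here) = All.lookup i∉ (∈-++⁺ʳ I (here refl)) refl
  ¬CycAdj-opposite (i ∷ I) (j ∷ J) (u∉ ∷ _) _ _ (inj₂ here) = All.lookup u∉ (here refl) refl
  ¬CycAdj-opposite {u} {v} (i ∷ I) (j ∷ J) uniq _ _ (inj₁ (there uv))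
    with () ← Consec-successor (i ∷ I ++ v ∷ j ∷ J) (Unique-rotate uniq) uv
  ¬CycAdj-opposite {u} {v} (i ∷ I) (j ∷ J) uniq@(u∉ ∷ _) _ _ (inj₂ (there vu))
    with refl ← Consec-successor (i ∷ I)
                  (subst Unique (++-assoc (i ∷ I) (v ∷ j ∷ J) (u ∷ [])) (Unique-rotate uniq))
                  (subst (λ l → Consec l v u) (++-assoc (i ∷ I) (v ∷ j ∷ J) (u ∷ [])) vu)
    = All.lookup u∉ (∈-++⁺ʳ (i ∷ I) (there (here refl))) refl

module Ears {n : ℕ} (G : Graph n) (x y : Fin n) (S : Subset n) where

  open import Data.List.Membership.DecPropositional (Fin._≟_ {n}) using (_∈?_)

  In-H : Fin n → Set
  In-H = InH G S x y

  Halo : Set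
  Halo = HaloIn G S x y x y

  record HPath (P : List (Fin n)) : Set where
    field
      path : PathFrom G x y P
      inH  : All In-H P

    unique : Unique P
    unique = proj₁ (proj₁ path)

    linked : Linked (Edge G) P
    linked = proj₂ (proj₁ path)

    starts : head P ≡ just x
    starts = proj₁ (proj₂ path)

    ends : last P ≡ just y
    ends = proj₂ (proj₂ path)

  record Ear (P : List (Fin n)) (u v : Fin n) (I : List (Fin n)) : Set where
    field
      unique   : Unique I
      disjoint : Disjoint I P
      linked   : Linked (Edge G) (u ∷ I ∷ʳ v)
      inH      : All In-H I

  Ear-reverse : ∀ {P u v I} → Ear P u v I → Ear P v u (reverse I)
  Ear-reverse ear = record
    { unique   = Unique-reverse unique
    ; disjoint = λ (p , q) → disjoint (reverse⁻ p , q)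
    ; linked   = Linked-reverse-∷-∷ʳ (Edge-sym G) linked
    ; inH      = All.anti-mono reverse⁻ inH
    }
    where open Ear ear

  Ear-anti-mono : ∀ {P Q u v I} → Q ⊆ P → Ear P u v I → Ear Q u v I
  Ear-anti-mono Q⊆P ear = record
    { unique = unique ; disjoint = λ (p , q) → disjoint (p , Q⊆P q) ; linked = linked ; inH = inH }
    where open Ear ear

  Ear-split : ∀ {P u v} I {q J} → Ear P u v (I ++ q ∷ J) → Ear P u q I × Ear P q v J
  Ear-split {u = u} {v} I {q} {J} ear
    with uI , _ ∷ uJ , _ ← Unique-++⁻ I (Ear.unique ear)
       | lI , lJ ← Linked-++⁻ (u ∷ I)
                     (subst (Linked (Edge G)) (cong (u ∷_) (++-assoc I (q ∷ J) (v ∷ []))) (Ear.linked ear))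
       | hI , _ ∷ hJ ← All.++⁻ I (Ear.inH ear)
    = record { unique = uI ; disjoint = λ (p , r) → Ear.disjoint ear (∈-++⁺ˡ p , r) ; linked = lI ; inH = hI } ,
      record { unique = uJ ; disjoint = λ (p , r) → Ear.disjoint ear (∈-++⁺ʳ I (there p) , r)
             ; linked = lJ ; inH = hJ }

  Ear-join : ∀ {P u q v I J} → Ear P u q I → Ear P q v J → In-H q → q ∉ P → Unique (I ++ q ∷ J) →
    Ear P u v (I ++ q ∷ J)
  Ear-join {P} {u} {q} {v} {I} {J} earI earJ hq q∉P uIqJ = record
    { unique   = uIqJ
    ; disjoint = λ (p , r) → [ (λ p → Ear.disjoint earI (p , r))
                               , (λ { (here eq) → q∉P (subst (_∈ P) eq r) ; (there p) → Ear.disjoint earJ (p , r) })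
                               ]′ (∈-++⁻ I p)
    ; linked   = subst (Linked (Edge G)) (cong (u ∷_) (sym (++-assoc I (q ∷ J) (v ∷ []))))
                   (Linked-++⁺ (u ∷ I) (Ear.linked earI) (Ear.linked earJ))
    ; inH      = All.++⁺ (Ear.inH earI) (hq ∷ Ear.inH earJ)
    }

  splice : ∀ A {u v} D {I} → HPath (A ++ u ∷ v ∷ D) → Ear (A ++ u ∷ v ∷ D) u v I →
    HPath (A ++ u ∷ I ++ v ∷ D)
  splice A D hp ear with l₁ , _ , l₃ ← Linked-segments⁻ A {ys = []} (HPath.linked hp) = record
    { path = (Unique-insert⁺ A unique E.unique E.disjoint , Linked-segments⁺ A l₁ E.linked l₃) ,
             trans (head-++ A) (trans (sym (head-++ A)) starts) ,
             trans (last-segments A) (trans (sym (last-segments A {ys = []})) ends)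
    ; inH  = All-insert⁺ A inH E.inH
    }
    where
    open HPath hp
    module E = Ear ear

  shortcut : ∀ A {u} B {v} D → HPath (A ++ u ∷ B ++ v ∷ D) → Edge G u v →
    HPath (A ++ u ∷ v ∷ D) × Ear (A ++ u ∷ v ∷ D) u v B
  shortcut A B D hp uv
    with l₁ , l₂ , l₃ ← Linked-segments⁻ A (HPath.linked hp)
       | uP , uB , B#P ← Unique-insert⁻ A (HPath.unique hp)
       | hP , hB ← All-insert⁻ A (HPath.inH hp)
    = record
        { path = (uP , Linked-segments⁺ A {ys = []} l₁ (uv ∷ [-]) l₃) ,
                 trans (head-++ A) (trans (sym (head-++ A)) (HPath.starts hp)) ,
                 trans (last-segments A {ys = []}) (trans (sym (last-segments A)) (HPath.ends hp))
        ; inH  = hP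
        } ,
      record { unique = uB ; disjoint = B#P ; linked = l₂ ; inH = hB }

  halo-of-ear : ∀ {P} A {u} B {v} D {I} → HPath P → P ≡ A ++ u ∷ B ++ v ∷ D →
    B ≢ [] → Ear P u v I → I ≢ [] → Halo
  halo-of-ear A {u} B {v} D {I} hp refl B≢[] ear I≢[] =
    C , A ∷ʳ u , reverse (v ∷ D) , u , v ,
    IsCycle-of-paths G I (reverse B) E.linked (Linked-reverse-∷-∷ʳ (Edge-sym G) uBv) unique-C I≢[] ,
    All.tabulate (λ z∈C → [ All.lookup E.inH , All.lookup H.inH ∘ uBv⊆P ]′ (∈-cycle⁻ I B z∈C)) ,
    PathFrom-prefix G A H.path , All.anti-mono L⊆P H.inH , here refl , L∩C⊆u ,
    PathFrom-reverse G (PathFrom-suffix G (A ++ u ∷ B)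
      (subst (PathFrom G x y) (sym (++-assoc A (u ∷ B) (v ∷ D))) H.path)) ,
    All.anti-mono (R⊆P ∘ reverse⁻) H.inH , there (∈-++⁺ʳ I (here refl)) , R∩C⊆v ,
    (λ _ p q → L#BR (p , ∈-++⁺ʳ B (reverse⁻ q))) , u≢v ,
    ¬CycAdj-opposite G I (reverse B) unique-C I≢[] (λ eq → B≢[] (reverse-injective eq))
    where
    module H = HPath hp
    module E = Ear ear
    C = u ∷ I ++ v ∷ reverse B
    P = A ++ u ∷ B ++ v ∷ D
    L⊆P : A ∷ʳ u ⊆ P
    L⊆P = Subset.++⁺ʳ A (Subset.xs⊆xs++ys (u ∷ []) _)
    R⊆P : v ∷ D ⊆ P
    R⊆P = ∈-++⁺ʳ A ∘ there ∘ ∈-++⁺ʳ B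
    uBv⊆P : u ∷ B ∷ʳ v ⊆ P
    uBv⊆P = ∈-++⁺ʳ A ∘ Subset.∷⁺ʳ u (Subset.++⁺ʳ B (Subset.xs⊆xs++ys (v ∷ []) D))
    pieces = Unique-segments⁻ A H.unique
    L#BR : Disjoint (A ∷ʳ u) (B ++ v ∷ D)
    L#BR = proj₁ (proj₂ pieces)
    u≢v : u ≢ v
    u≢v eq = L#BR (∈-++⁺ʳ A (here refl) , ∈-++⁺ʳ B (here eq))
    uBv : Linked (Edge G) (u ∷ B ∷ʳ v)
    uBv = proj₁ (proj₂ (Linked-segments⁻ A H.linked))
    unique-C : Unique C
    unique-C = Unique-cycle I B (proj₁ (IsPath-segment G A (proj₁ H.path))) E.unique
                 λ (p , q) → E.disjoint (p , uBv⊆P q)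
    L∩C⊆u : ∀ z → z ∈ A ∷ʳ u → z ∈ C → z ≡ u
    L∩C⊆u z z∈L z∈C with ∈-cycle⁻ I B z∈C
    ... | inj₁ z∈I          = ⊥-elim (E.disjoint (z∈I , L⊆P z∈L))
    ... | inj₂ (here eq)    = eq
    ... | inj₂ (there z∈Bv) = ⊥-elim (L#BR (z∈L , Subset.++⁺ʳ B (Subset.xs⊆xs++ys (v ∷ []) D) z∈Bv))
    R∩C⊆v : ∀ z → z ∈ reverse (v ∷ D) → z ∈ C → z ≡ v
    R∩C⊆v z z∈revR z∈C with reverse⁻ z∈revR | ∈-cycle⁻ I B z∈C
    ... | z∈R | inj₁ z∈I = ⊥-elim (E.disjoint (z∈I , R⊆P z∈R))
    ... | z∈R | inj₂ z∈uBv with ∈-++⁻ (u ∷ B) z∈uBv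
    ...   | inj₁ (here refl) = ⊥-elim (L#BR (∈-++⁺ʳ A (here refl) , ∈-++⁺ʳ B z∈R))
    ...   | inj₁ (there z∈B) = ⊥-elim (proj₂ (proj₂ pieces) (z∈B , z∈R))
    ...   | inj₂ (here eq)   = eq

  data Landing (P L : List (Fin n)) (b : Fin n) (R : List (Fin n)) : Set where
    before : ∀ L₁ e L₂ J → L ≡ L₁ ++ e ∷ L₂ → Ear P e b J → L₂ ≢ [] ⊎ J ≢ [] → Landing P L b R
    after  : ∀ R₁ e R₂ J → R ≡ R₁ ++ e ∷ R₂ → Ear P b e J → R₁ ≢ [] ⊎ J ≢ [] → Landing P L b R

  landing-of-ear : ∀ {P} L {b} R {a c w J e} → P ≡ L ++ b ∷ R →
    last L ≡ just a → head R ≡ just c → w ≢ a → w ≢ c →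
    e ∈ P → e ≢ b → Ear P b e J → head (J ∷ʳ e) ≡ just w → Landing P L b R
  landing-of-ear L {b} R {a} {c} {w} {J} {e} refl last≡a head≡c w≢a w≢c e∈P e≢b ear head≡w
    with ∈-++⁻ L e∈P
  ... | inj₂ (here e≡b) = ⊥-elim (e≢b e≡b)
  ... | inj₁ e∈L with L₁ , L₂ , refl ← ∈-∃++ e∈L =
    before L₁ e L₂ (reverse J) refl (Ear-reverse ear) (nontrivial J head≡w)
    where
    nontrivial : ∀ J → head (J ∷ʳ e) ≡ just w → L₂ ≢ [] ⊎ reverse J ≢ []
    nontrivial []      e≡w = inj₁ λ L₂≡[] → w≢a (trans (sym (just-injective e≡w)) (just-injective
      (trans (sym (last-++ L₁)) (subst (λ L₂ → last (L₁ ++ e ∷ L₂) ≡ just a) L₂≡[] last≡a))))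
    nontrivial (j ∷ J) _   = inj₂ λ eq → case reverse-injective {x = j ∷ J} {y = []} eq of λ ()
  ... | inj₂ (there e∈R) with R₁ , R₂ , refl ← ∈-∃++ e∈R =
    after R₁ e R₂ J refl ear (nontrivial J head≡w)
    where
    nontrivial : ∀ J → head (J ∷ʳ e) ≡ just w → R₁ ≢ [] ⊎ J ≢ []
    nontrivial []      e≡w = inj₁ λ R₁≡[] → w≢c (trans (sym (just-injective e≡w)) (just-injective
      (subst (λ R₁ → head (R₁ ++ e ∷ R₂) ≡ just c) R₁≡[] head≡c)))
    nontrivial (j ∷ J) _   = inj₂ λ ()

  internal-vertex-∈S : ∀ {P} L {b} R → HPath P → P ≡ L ++ b ∷ R → L ≢ [] → R ≢ [] → b ∈ₛ S
  internal-vertex-∈S []      _       _  _    L≢[] _    = ⊥-elim (L≢[] refl)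
  internal-vertex-∈S (_ ∷ _) []      _  _    _    R≢[] = ⊥-elim (R≢[] refl)
  internal-vertex-∈S (l ∷ L) {b} (r ∷ R) hp refl _ _
    with All.lookup (HPath.inH hp) (∈-++⁺ʳ (l ∷ L) (here refl))
  ... | inj₁ b∈S         = b∈S
  ... | inj₂ (inj₁ b≡x) =
    ⊥-elim (proj₂ (proj₂ (Unique-++⁻ (l ∷ L) (HPath.unique hp)))
             (here (sym (just-injective (HPath.starts hp))) , here (sym b≡x)))
  ... | inj₂ (inj₂ b≡y) with b∉R ∷ _ ← proj₁ (proj₂ (Unique-++⁻ (l ∷ L) (HPath.unique hp))) =
    ⊥-elim (All.lookup b∉R (last⇒∈ (trans (sym (last-++ (l ∷ L))) (HPath.ends hp))) b≡y)

  record Config (P : List (Fin n)) : Set where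
    constructor config
    field
      A          : List (Fin n)
      u          : Fin n
      B          : List (Fin n)
      v          : Fin n
      D          : List (Fin n)
      I          : List (Fin n)
      split      : P ≡ A ++ u ∷ B ++ v ∷ D
      ear        : Ear P u v I
      nontrivial : B ≢ [] ⊎ I ≢ []

  record Chorded (P : List (Fin n)) : Set where
    constructor chorded
    field
      A        : List (Fin n)
      u        : Fin n
      B        : List (Fin n)
      v        : Fin n
      D        : List (Fin n)
      split    : P ≡ A ++ u ∷ B ++ v ∷ D
      bypassed : B ≢ []
      chord    : Edge G u v

  data Progress (P : List (Fin n)) (m : ℕ) : Set where
    halo     : Halo → Progress P m
    longer   : ∀ {P′} → HPath P′ → length P < length P′ → Chorded P′ → Progress P m
    narrower : (ch : Chorded P) → length (Chorded.B ch) < m → Progress P m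

  Progress-mono : ∀ {P m m′} → m ≤ m′ → Progress P m → Progress P m′
  Progress-mono _   (halo h)            = halo h
  Progress-mono _   (longer hp grew ch) = longer hp grew ch
  Progress-mono m≤m′ (narrower ch b<m)  = narrower ch (<-≤-trans b<m m≤m′)

  config-of-landing : ∀ {P} L {b} R → P ≡ L ++ b ∷ R → Landing P L b R → Config P
  config-of-landing L {b} R P≡ (before L₁ e L₂ J L≡ ear nt) =
    config L₁ e L₂ b R J (trans P≡ (trans (cong (_++ b ∷ R) L≡) (++-assoc L₁ (e ∷ L₂) (b ∷ R)))) ear nt
  config-of-landing L {b} R P≡ (after R₁ e R₂ J R≡ ear nt) =
    config L b R₁ e R₂ J (trans P≡ (cong (λ R → L ++ b ∷ R) R≡)) ear nt

  advance-config : ∀ {P} → HPath P → (c : Config P) → Progress P (suc (length (Config.B c)))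
  advance-config _  (config _ _ []      _ _ []      _     _   (inj₁ B≢[])) = ⊥-elim (B≢[] refl)
  advance-config _  (config _ _ []      _ _ []      _     _   (inj₂ I≢[])) = ⊥-elim (I≢[] refl)
  advance-config hp (config A _ (b ∷ B) _ D (_ ∷ _) split ear _) =
    halo (halo-of-ear A (b ∷ B) D hp split (λ ()) ear (λ ()))
  advance-config _  (config A u (b ∷ B) v D []      split ear _) =
    narrower (chorded A u (b ∷ B) v D split (λ ()) (Linked.head (Ear.linked ear))) ≤-refl
  advance-config hp (config A u []      v D (i ∷ I) refl  ear _) =
    longer (splice A D hp ear) (length-insert< A I)
      (chorded A u (i ∷ I) v D refl (λ ())
        (Linked.head (proj₁ (proj₂ (Linked-segments⁻ A {ys = []} (HPath.linked hp))))))

  halo-via-shortcut-before : ∀ {P} A {u} M₁ {q} M₂ {v} D {L₁ e A₂ J} → HPath P →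
    P ≡ A ++ u ∷ (M₁ ++ q ∷ M₂) ++ v ∷ D → Edge G u v → A ≡ L₁ ++ e ∷ A₂ → Ear P e q J → Halo
  halo-via-shortcut-before A {u} M₁ {q} M₂ {v} D {L₁} {e} {A₂} {J} hp refl uv refl ear
    with hp′ , bypassed ← shortcut A (M₁ ++ q ∷ M₂) D hp uv
    with _ , q-to-v ← Ear-split M₁ bypassed
    = halo-of-ear L₁ (A₂ ∷ʳ u) D hp′ regroup (++-∷-≢-[] A₂)
        (Ear-join (Ear-anti-mono (insert-⊆ A) ear) q-to-v q∈H q∉Ps unique-JqM₂) (++-∷-≢-[] J)
    where
    q∈P : q ∈ A ++ u ∷ (M₁ ++ q ∷ M₂) ++ v ∷ D
    q∈P = ∈-++⁺ʳ A (there (∈-++⁺ˡ (∈-++⁺ʳ M₁ (here refl))))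
    q∈H : In-H q
    q∈H = All.lookup (HPath.inH hp) q∈P
    q∉Ps : q ∉ A ++ u ∷ v ∷ D
    q∉Ps q∈ = Ear.disjoint bypassed (∈-++⁺ʳ M₁ (here refl) , q∈)
    unique-JqM₂ : Unique (J ++ q ∷ M₂)
    unique-JqM₂ = Unique-++⁺ (Ear.unique ear) (proj₁ (proj₂ (Unique-++⁻ M₁ (Ear.unique bypassed))))
      λ (p , r) → Ear.disjoint ear (p , ∈-++⁺ʳ A (there (∈-++⁺ˡ (∈-++⁺ʳ M₁ r))))
    regroup : A ++ u ∷ v ∷ D ≡ L₁ ++ e ∷ (A₂ ∷ʳ u) ++ v ∷ D
    regroup = trans (++-assoc L₁ (e ∷ A₂) (u ∷ v ∷ D))
                    (cong (λ t → L₁ ++ e ∷ t) (sym (++-assoc A₂ (u ∷ []) (v ∷ D))))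

  halo-via-shortcut-after : ∀ {P} A {u} M₁ {q} M₂ {v} D {N₁ e R₂ J} → HPath P →
    P ≡ A ++ u ∷ (M₁ ++ q ∷ M₂) ++ v ∷ D → Edge G u v → D ≡ N₁ ++ e ∷ R₂ → Ear P q e J → Halo
  halo-via-shortcut-after A {u} M₁ {q} M₂ {v} D {N₁} {e} {R₂} {J} hp refl uv refl ear
    with hp′ , bypassed ← shortcut A (M₁ ++ q ∷ M₂) D hp uv
    with u-to-q , _ ← Ear-split M₁ bypassed
    = halo-of-ear A (v ∷ N₁) R₂ hp′ refl (λ ())
        (Ear-join u-to-q (Ear-anti-mono (insert-⊆ A) ear) q∈H q∉Ps unique-M₁qJ) (++-∷-≢-[] M₁)
    where
    q∈P : q ∈ A ++ u ∷ (M₁ ++ q ∷ M₂) ++ v ∷ D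
    q∈P = ∈-++⁺ʳ A (there (∈-++⁺ˡ (∈-++⁺ʳ M₁ (here refl))))
    q∈H : In-H q
    q∈H = All.lookup (HPath.inH hp) q∈P
    q∉Ps : q ∉ A ++ u ∷ v ∷ D
    q∉Ps q∈ = Ear.disjoint bypassed (∈-++⁺ʳ M₁ (here refl) , q∈)
    unique-M₁qJ : Unique (M₁ ++ q ∷ J)
    unique-M₁qJ with uM₁ , _ , M₁#qM₂ ← Unique-++⁻ M₁ (Ear.unique bypassed) =
      Unique-++⁺ uM₁ (All.¬Any⇒All¬ J (λ q∈J → Ear.disjoint ear (q∈J , q∈P)) ∷ Ear.unique ear) λ where
        (p , here refl) → M₁#qM₂ (p , here refl)
        (p , there r)   → Ear.disjoint ear (r , ∈-++⁺ʳ A (there (∈-++⁺ˡ (∈-++⁺ˡ p))))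

  landing-from-bypassed : ∀ {P} A {u} M₁ {q} M₂ {v} D → HPath P → P ≡ A ++ u ∷ (M₁ ++ q ∷ M₂) ++ v ∷ D →
    Edge G u v →
    Landing P (A ++ u ∷ M₁) q (M₂ ++ v ∷ D) → Progress P (length (M₁ ++ q ∷ M₂))
  landing-from-bypassed A {u} M₁ {q} M₂ {v} D hp refl uv lnd@(before L₁ e L₂ J L≡ ear _)
    with locate-in-++ L₁ A (sym L≡)
  ... | inj₁ (_ , A≡ , _)     = halo (halo-via-shortcut-before A M₁ M₂ D hp refl uv A≡ ear)
  ... | inj₂ (N₁ , u∷M₁≡ , _) =
    Progress-mono (≤-trans (subst (λ l → length L₂ < length l) (sym u∷M₁≡) (length-suffix< N₁ L₂))
                           (length-prefix< M₁))
      (advance-config hp (config-of-landing (A ++ u ∷ M₁) (M₂ ++ v ∷ D) (++-regroup A M₁ M₂ (v ∷ D)) lnd))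
  landing-from-bypassed A {u} M₁ {q} M₂ {v} D hp refl uv lnd@(after R₁ e R₂ J R≡ ear _)
    with locate-in-++ R₁ (M₂ ∷ʳ v) (trans (sym R≡) (sym (++-assoc M₂ (v ∷ []) D)))
  ... | inj₂ (_ , D≡ , _)      = halo (halo-via-shortcut-after A M₁ M₂ D hp refl uv D≡ ear)
  ... | inj₁ (_ , M₂∷ʳv≡ , _) =
    Progress-mono (≤-trans (subst (λ l → length R₁ < length l) (sym M₂∷ʳv≡) (length-prefix< R₁))
                           (subst (_≤ length (M₁ ++ q ∷ M₂)) (sym (length-∷ʳ M₂)) (length-suffix< M₁ M₂)))
      (advance-config hp (config-of-landing (A ++ u ∷ M₁) (M₂ ++ v ∷ D) (++-regroup A M₁ M₂ (v ∷ D)) lnd))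

  module _ (comp : IsComponent G x y S) where

    stays-in-S : ∀ {p} J {K} → p ∈ₛ S → Linked (Edge G) (p ∷ J ++ K) → x ∉ J → y ∉ J → All (_∈ₛ S) J
    stays-in-S []      _   _        _   _   = []
    stays-in-S (j ∷ J) p∈S (pj ∷ l) x∉J y∉J = j∈S ∷ stays-in-S J j∈S l (x∉J ∘ there) (y∉J ∘ there)
      where
      j∈S : j ∈ₛ S
      j∈S = proj₂ (proj₂ (proj₂ (proj₂ comp))) _ j p∈S pj
              (λ j≡x → x∉J (here (sym j≡x))) (λ j≡y → y∉J (here (sym j≡y)))

    module _ (tc : TwoConnected G) where

      ear-from : ∀ {P b w} → HPath P → b ∈ₛ S → Edge G b w →
        ∃₂ λ J e → e ∈ P × e ≢ b × Ear P b e J × head (J ∷ʳ e) ≡ just w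
      ear-from {P} {b} {w} hp b∈S bw
        with ws , ((uniq , linked) , head≡w , last≡x) , avoids-b
               ← proj₂ (proj₂ tc) b w x (λ w≡b → Edge-irrefl G (subst (Edge G b) w≡b bw))
                                        (λ x≡b → proj₁ comp (subst (_∈ₛ S) (sym x≡b) b∈S))
        with First.first (λ z → swap (toSum (z ∈? P))) ws
      ... | inj₂ all-off = ⊥-elim (All.lookup all-off (last⇒∈ last≡x) (head⇒∈ (HPath.starts hp)))
      ... | inj₁ fst with toView fst
      ... | First._++_∷_ {J} {e} J-off e∈P rest =
        J , e , e∈P , All.lookup avoids-b (∈-++⁺ʳ J (here refl)) , ear , trans (sym (head-++ J)) head≡w
        where
        linked-bJe : Linked (Edge G) (b ∷ J ∷ʳ e)
        linked-bJe = Linked-∷⁺ bw (trans (sym (head-++ J)) head≡w) (proj₁ (Linked-++⁻ J linked))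
        ear : Ear P b e J
        ear = record
          { unique   = proj₁ (Unique-++⁻ J uniq)
          ; disjoint = λ (p , q) → All.lookup J-off p q
          ; linked   = linked-bJe
          ; inH      = All.map inj₁ (stays-in-S J b∈S linked-bJe
                         (λ x∈J → All.lookup J-off x∈J (head⇒∈ (HPath.starts hp)))
                         (λ y∈J → All.lookup J-off y∈J (last⇒∈ (HPath.ends hp))))
          }

      landing-at-branch-vertex : ∀ {P} L {b} R → HPath P → P ≡ L ++ b ∷ R → L ≢ [] → R ≢ [] → deg G b ≢ 2 →
        Landing P L b R
      landing-at-branch-vertex L       []      _  _    _    R≢[] _ = ⊥-elim (R≢[] refl)
      landing-at-branch-vertex L {b} (c ∷ R) hp refl L≢[] _ deg≢2 with initLast L
      ... | [] = ⊥-elim (L≢[] refl)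
      ... | L′ ∷ʳ′ a
        with ba , bc , a≢c ← IsPath-neighbours G L′ R (proj₁ (HPath.path hp))
        with w , bw , w≢a , w≢c ← third-neighbour G a≢c ba bc deg≢2
        with J , e , e∈P , e≢b , ear , head≡w
               ← ear-from hp (internal-vertex-∈S (L′ ∷ʳ a) (c ∷ R) hp refl L≢[] (λ ())) bw
        = landing-of-ear (L′ ∷ʳ a) (c ∷ R) refl (last-++ L′) refl w≢a w≢c e∈P e≢b ear head≡w

      module _ (nc : NoCompliantEdges G) where

        advance-chord : ∀ {P} → HPath P → (ch : Chorded P) → Progress P (length (Chorded.B ch))
        advance-chord hp (chorded A u B v D refl B≢[] uv)
          with q , q∈B , deg≢2
                 ← find (detour-has-branch-vertex G nc B uv (IsPath-segment G A (proj₁ (HPath.path hp))) B≢[])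
          with M₁ , M₂ , refl ← ∈-∃++ q∈B
          = landing-from-bypassed A M₁ M₂ D hp refl uv
              (landing-at-branch-vertex (A ++ u ∷ M₁) (M₂ ++ v ∷ D) hp (++-regroup A M₁ M₂ (v ∷ D))
                 (++-∷-≢-[] A) (++-∷-≢-[] M₂) deg≢2)

        halo-of-chorded : ∀ k {P} → HPath P → Chorded P → n ∸ length P < k → Halo
        halo-of-narrowing : ∀ k m {P} → HPath P → (ch : Chorded P) →
          n ∸ length P ≤ k → length (Chorded.B ch) < m → Halo

        halo-of-chorded zero    _  _  ()
        halo-of-chorded (suc k) hp ch slack< = halo-of-narrowing k _ hp ch (≤-pred slack<) ≤-refl

        halo-of-narrowing k zero    _  _  _      ()
        halo-of-narrowing k (suc m) hp ch slack≤ width< with advance-chord hp ch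
        ... | halo h                = h
        ... | narrower ch′ narrowed = halo-of-narrowing k m hp ch′ slack≤ (<-≤-trans narrowed (≤-pred width<))
        ... | longer hp′ grew ch′   = halo-of-chorded k hp′ ch′
                                        (<-≤-trans (∸-monoʳ-< grew (Unique⇒length≤ (HPath.unique hp′))) slack≤)

        halo-of-config : ∀ {P} → HPath P → Config P → Halo
        halo-of-config hp c with advance-config hp c
        ... | halo h          = h
        ... | longer hp′ _ ch = halo-of-chorded _ hp′ ch ≤-refl
        ... | narrower ch _   = halo-of-chorded _ hp ch ≤-refl

lemma1 : ∀ {n : ℕ} (G : Graph n) → TwoConnected G → NoCompliantEdges G →
    (x y : Fin n) (S : Subset n) → IsComponent G x y S →
    (∃ λ (xs : List (Fin n)) → PathFrom G x y xs × All (InH G S x y) xs ×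
       NonFlat G xs × 2 ≤ len xs) →
    HaloIn G S x y x y
-- The bound 2 ≤ len xs is implied by the internal vertex that non-flatness provides.
lemma1 G tc nc x y S comp (xs , path , inH , nonflat , _)
  with L , R , b , refl , L≢[] , R≢[] , 3≤deg ← Any-interior⇒split xs nonflat
  = halo-of-config comp tc nc hp
      (config-of-landing L R refl (landing-at-branch-vertex comp tc L R hp refl L≢[] R≢[] (>⇒≢ 3≤deg)))
  where
  open Ears G x y S
  hp : HPath (L ++ b ∷ R)
  hp = record { path = path ; inH = inH }
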